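{- Let $\ell:\{0,1\}^n\to\{0,1\}$, let $\beta$ be an orientation of $\ell$ and $\gamma$ an orientation of $\bar\ell=1-\ell$. Then for all $x,y\in\{0,1\}^n$ with $x_i=y_i$ for every $i$ such that $\beta_i=1$ or $\gamma_i=1$, we have $\ell(x)=\ell(y)$.
   Context: $g$ has orientation $\beta\in\{0,1\}^n$ if there is a monotone $h:\{0,1\}^{2n}\to\{0,1\}$ with $g(x)=h(x,x\oplus\beta)$ for all $x$. -}

module Defs where

open import Data.Bool using (Bool; true; false; not; _xor_)
open import Data.Bool.Properties using ()
open import Data.Vec using (Vec; _++_; zipWith; lookup)
open import Data.Fin using (Fin)
open import Data.Nat using (ℕ; _+_)
open import Data.Product using (Σ; _×_)
open import Data.Sum using (_⊎_)
open import Relation.Binary.PropositionalEquality using (_≡_)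

open import Data.Bool using (_≤_) public

_≤ᵥ_ : ∀ {m} → Vec Bool m → Vec Bool m → Set
_≤ᵥ_ {m} u v = (i : Fin m) → lookup u i ≤ lookup v i

Monotone : ∀ {m} → (Vec Bool m → Bool) → Set
Monotone {m} h = ∀ (u v : Vec Bool m) → u ≤ᵥ v → h u ≤ h v

_⊕_ : ∀ {n} → Vec Bool n → Vec Bool n → Vec Bool n
x ⊕ β = zipWith _xor_ x β

HasOrientation : ∀ {n} → (Vec Bool n → Bool) → Vec Bool n → Set
HasOrientation {n} g β =
  Σ (Vec Bool (n + n) → Bool) λ h → Monotone h × (∀ x → g x ≡ h (x ++ (x ⊕ β)))

complement : ∀ {n} → (Vec Bool n → Bool) → Vec Bool n → Bool
complement ℓ x = not (ℓ x)

module Submission where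

-- Call the support of β the set of coordinates i with βᵢ = 1.
-- If g has orientation β via a monotone h, then g(x) = h(x, x ⊕ β); for
-- u ≤ v agreeing on the support of β we also have u ⊕ β ≤ v ⊕ β, so
-- g u ≤ g v.  Applying this to ℓ (orientation β) and to ℓ̄ (orientation γ)
-- gives ℓ u ≤ ℓ v and ¬ℓ u ≤ ¬ℓ v, hence ℓ u = ℓ v, whenever u ≤ v agree
-- on the union of the two supports.  For arbitrary x, y agreeing there,
-- the meet x ∧ y lies below both and still agrees with each of them on
-- that union, so ℓ x = ℓ (x ∧ y) = ℓ y.

open import Defs
open import Data.Bool using (Bool; true; false; not; _xor_; _∧_; b≤b; f≤t)
open import Data.Bool.Properties using (≤-antisym; ∧-idem)
open import Data.Vec using (Vec; lookup; []; _∷_; zipWith; _++_)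
open import Data.Vec.Properties using (lookup-zipWith)
open import Data.Fin using (Fin; zero; suc)
open import Data.Nat using (ℕ)
open import Data.Sum using (_⊎_; inj₁; inj₂)
open import Data.Product using (_,_)
open import Relation.Binary.PropositionalEquality
  using (_≡_; refl; sym; trans; cong; subst₂; module ≡-Reasoning)
open ≡-Reasoning

AgreeOn : ∀ {n} → Vec Bool n → Vec Bool n → Vec Bool n → Set
AgreeOn {n} β u v = (i : Fin n) → lookup β i ≡ true → lookup u i ≡ lookup v i

xor-mono-bit : ∀ {a b} c → a ≤ b → (c ≡ true → a ≡ b) → (a xor c) ≤ (b xor c)
xor-mono-bit true _ a≡b rewrite a≡b refl = b≤b
xor-mono-bit {false} {false} false _ _ = b≤b
xor-mono-bit {false} {true}  false _ _ = f≤t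
xor-mono-bit {true}  {true}  false _ _ = b≤b

not-≤-flip : ∀ a b → not a ≤ not b → b ≤ a
not-≤-flip false false _ = b≤b
not-≤-flip true  false _ = f≤t
not-≤-flip true  true  _ = b≤b

∧-≤ˡ : ∀ a b → (a ∧ b) ≤ a
∧-≤ˡ false _     = b≤b
∧-≤ˡ true  false = f≤t
∧-≤ˡ true  true  = b≤b

∧-≤ʳ : ∀ a b → (a ∧ b) ≤ b
∧-≤ʳ false false = b≤b
∧-≤ʳ false true  = f≤t
∧-≤ʳ true  _     = b≤b

++-mono : ∀ {m k} (a a' : Vec Bool m) (b b' : Vec Bool k) →
  a ≤ᵥ a' → b ≤ᵥ b' → (a ++ b) ≤ᵥ (a' ++ b')
++-mono []      []        _ _ _   b≤b' i       = b≤b' i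
++-mono (_ ∷ _) (_ ∷ _)   _ _ a≤a' _    zero    = a≤a' zero
++-mono (_ ∷ a) (_ ∷ a')  b b' a≤a' b≤b' (suc i) =
  ++-mono a a' b b' (λ j → a≤a' (suc j)) b≤b' i

⊕-mono : ∀ {n} (β u v : Vec Bool n) → u ≤ᵥ v → AgreeOn β u v → (u ⊕ β) ≤ᵥ (v ⊕ β)
⊕-mono β u v u≤v agree i =
  subst₂ _≤_ (sym (lookup-zipWith _xor_ i u β)) (sym (lookup-zipWith _xor_ i v β))
    (xor-mono-bit (lookup β i) (u≤v i) (agree i))

meet : ∀ {n} → Vec Bool n → Vec Bool n → Vec Bool n
meet = zipWith _∧_

meet-≤ˡ : ∀ {n} (x y : Vec Bool n) → meet x y ≤ᵥ x
meet-≤ˡ x y i = subst₂ _≤_ (sym (lookup-zipWith _∧_ i x y)) refl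
  (∧-≤ˡ (lookup x i) (lookup y i))

meet-≤ʳ : ∀ {n} (x y : Vec Bool n) → meet x y ≤ᵥ y
meet-≤ʳ x y i = subst₂ _≤_ (sym (lookup-zipWith _∧_ i x y)) refl
  (∧-≤ʳ (lookup x i) (lookup y i))

meet-agreeˡ : ∀ {n} (x y : Vec Bool n) (i : Fin n) →
  lookup x i ≡ lookup y i → lookup (meet x y) i ≡ lookup x i
meet-agreeˡ x y i xᵢ≡yᵢ = begin
  lookup (meet x y) i       ≡⟨ lookup-zipWith _∧_ i x y ⟩
  lookup x i ∧ lookup y i   ≡⟨ cong (lookup x i ∧_) (sym xᵢ≡yᵢ) ⟩
  lookup x i ∧ lookup x i   ≡⟨ ∧-idem (lookup x i) ⟩
  lookup x i                ∎

meet-agreeʳ : ∀ {n} (x y : Vec Bool n) (i : Fin n) →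
  lookup x i ≡ lookup y i → lookup (meet x y) i ≡ lookup y i
meet-agreeʳ x y i xᵢ≡yᵢ = trans (meet-agreeˡ x y i xᵢ≡yᵢ) xᵢ≡yᵢ

-- A function with orientation β is monotone along pairs u ≤ v that
-- agree on the support of β: both blocks of (u, u ⊕ β) grow.
orientation-mono : ∀ {n} (g : Vec Bool n → Bool) (β u v : Vec Bool n) →
  HasOrientation g β → u ≤ᵥ v → AgreeOn β u v → g u ≤ g v
orientation-mono g β u v (h , h-mono , g≡h) u≤v agree =
  subst₂ _≤_ (sym (g≡h u)) (sym (g≡h v))
    (h-mono _ _ (++-mono u v (u ⊕ β) (v ⊕ β) u≤v (⊕-mono β u v u≤v agree)))

orientations-invariant : ∀ {n} (ℓ : Vec Bool n → Bool) (β γ u v : Vec Bool n) →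
  HasOrientation ℓ β → HasOrientation (complement ℓ) γ →
  u ≤ᵥ v → AgreeOn β u v → AgreeOn γ u v → ℓ u ≡ ℓ v
orientations-invariant ℓ β γ u v oβ oγ u≤v agreeβ agreeγ = ≤-antisym
  (orientation-mono ℓ β u v oβ u≤v agreeβ)
  (not-≤-flip (ℓ u) (ℓ v) (orientation-mono (complement ℓ) γ u v oγ u≤v agreeγ))

-- Main theorem: compare both x and y with their meet.
lemma2 : (n : ℕ) (ℓ : Vec Bool n → Bool) (β γ : Vec Bool n) →
    HasOrientation ℓ β → HasOrientation (complement ℓ) γ →
    (x y : Vec Bool n) →
    ((i : Fin n) → (lookup β i ≡ true ⊎ lookup γ i ≡ true) → lookup x i ≡ lookup y i) →
    ℓ x ≡ ℓ y
lemma2 n ℓ β γ oβ oγ x y agree = begin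
  ℓ x          ≡⟨ sym (via-meet x (meet-≤ˡ x y) (meet-agreeˡ x y)) ⟩
  ℓ (meet x y) ≡⟨ via-meet y (meet-≤ʳ x y) (meet-agreeʳ x y) ⟩
  ℓ y          ∎
  where
  via-meet : (v : Vec Bool n) → meet x y ≤ᵥ v →
    ((i : Fin n) → lookup x i ≡ lookup y i → lookup (meet x y) i ≡ lookup v i) →
    ℓ (meet x y) ≡ ℓ v
  via-meet v z≤v z-agree = orientations-invariant ℓ β γ (meet x y) v oβ oγ z≤v
    (λ i βᵢ → z-agree i (agree i (inj₁ βᵢ)))
    (λ i γᵢ → z-agree i (agree i (inj₂ γᵢ)))
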